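{- For all integers $b\geqslant 2$, the Kempner set $\mathcal{K}(\{0,1,\dots,b-2\},b)$ contains an arithmetic progression (with nonzero common difference) of length $(b-1)\beta(b)$. Hence $\ell(b)\geqslant (b-1)\beta(b)$.
   Context: For an integer $b\geqslant 2$ and a set $S\subseteq \{0,1,\dots,b-1\}$, the Kempner set $\mathcal{K}(S,b)$ is the set of non-negative integers whose base-$b$ expansions use only digits from $S$. It is called proper if $0\in S$ and $S\neq\{0,1,\dots,b-1\}$. $\ell(b)$ denotes the length (number of terms) of the longest arithmetic progression (with nonzero common difference) contained in some proper Kempner set of base $b$. For a positive integer $n$, $\rho(n)$ is the product of the distinct primes dividing $n$, and $\beta(b)$ is the largest positive integer $m<b$ with $\rho(m)\mid b$. -}

module Defs where

open import Data.Nat using (ℕ; zero; suc; _+_; _*_; _∸_; _<_; _≤_; _≤?_)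
open import Data.Nat.Divisibility using (_∣_; _∣?_)
open import Data.Nat.Primality using (Prime; prime?)
open import Data.List using (List; upTo; filter)
open import Data.Nat.ListAction using (product)
open import Data.Product using (_×_; Σ; ∃; ∃-syntax; _,_)
open import Relation.Nullary using (¬_; yes; no)
open import Relation.Nullary.Decidable using (_×-dec_)

-- Kempner set K(S,b): non-negative integers whose base-b expansion uses only
-- digits in S (digits are < b). Built from the expansion n = d + b * n'.
-- (Leading zeros never arise in the standard expansion; 0 has the empty
-- expansion.)  Since the standard expansion of a positive n is d + b*n' with
-- d = n mod b, n' = n div b, this inductive description is the usual one
-- whenever 0 ∈ S, which is the case for all sets considered below.
data Kempner (S : ℕ → Set) (b : ℕ) : ℕ → Set where
  kz : Kempner S b 0
  kd : ∀ {n} d → d < b → S d → Kempner S b n → Kempner S b (d + b * n)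

Proper : (S : ℕ → Set) → ℕ → Set
Proper S b = S 0 × ∃[ d ] (d < b × ¬ S d)

ContainsAP : (ℕ → Set) → ℕ → Set
ContainsAP K L = ∃[ a ] ∃[ d ] (0 < d × (∀ i → i < L → K (a + i * d)))

ρ : ℕ → ℕ
ρ n = product (filter (λ p → prime? p ×-dec (p ∣? n)) (upTo (suc n)))

-- β(b): largest positive m < b with ρ(m) ∣ b (m = 1 always qualifies).
-- βsearch k b = largest m with 1 ≤ m ≤ k satisfying the condition (or 0).
βsearch : ℕ → ℕ → ℕ
βsearch zero b = zero
βsearch (suc k) b with ρ (suc k) ∣? b
... | yes _ = suc k
... | no _ = βsearch k b

β : ℕ → ℕ
β b = βsearch (b ∸ 1) b

Upto-b-2 : ℕ → ℕ → Set
Upto-b-2 b d = d < b ∸ 1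

-- ℓ(b) ≥ L  ⇔  some proper Kempner set in base b contains an AP of length L
ℓ≥ : ℕ → ℕ → Set₁
ℓ≥ b L = Σ (ℕ → Set) λ S → Proper S b × ContainsAP (Kempner S b) L

{-# OPTIONS --safe #-}
module Submission where

-- Let m = β(b) and write b^k = c m (possible since every prime factor of m
-- divides b).  For s < m the k-digit base-b expansion of s c = s b^k / m is the
-- first k digits of the expansion of the fraction s / m, and every such digit
-- has the form ⌊r b / m⌋ with r < m < b, hence is at most b - 2.  Prepending a
-- leading digit q < b - 1 gives i c = q b^k + s c for i = q m + s, so
-- 0, c, 2c, …, ((b - 1) m - 1) c all lie in K({0,…,b-2}, b).

open import Defs
open import Data.Nat
open import Data.Nat.Properties
open import Data.Nat.Divisibility
open import Data.Nat.DivMod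
open import Data.Nat.Primality using (Prime; prime?)
open import Data.Nat.Primality.Factorisation
  using (PrimeFactorisation; factorise; factors)
open import Data.Nat.ListAction using (product)
open import Data.Nat.ListAction.Properties using (∈⇒∣product)
open import Data.List using (List; []; _∷_; length)
open import Data.List.Membership.Propositional.Properties using (∈-upTo⁺; ∈-filter⁺)
open import Data.List.Relation.Unary.All as All using (All; []; _∷_)
open import Data.Product using (_×_; _,_; ∃-syntax; map₁; map₂)
open import Relation.Nullary using (yes; no; contradiction)
open import Relation.Nullary.Decidable using (_×-dec_)
open import Relation.Binary.PropositionalEquality
open import Data.Nat.Solver using (module +-*-Solver)
open +-*-Solver using (solve; _:+_; _:*_; _:=_; con)

prime∣⇒∣ρ : ∀ {p m} .{{_ : NonZero m}} → Prime p → p ∣ m → p ∣ ρ m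
prime∣⇒∣ρ {p} {m} p-prime p∣m =
  ∈⇒∣product (∈-filter⁺ (λ q → prime? q ×-dec (q ∣? m))
    (∈-upTo⁺ (s≤s (∣⇒≤ p∣m))) (p-prime , p∣m))

product∣^length : ∀ {b} (ps : List ℕ) → All (_∣ b) ps → product ps ∣ b ^ length ps
product∣^length []       []         = ∣-refl
product∣^length (p ∷ ps) (p∣b ∷ ps∣b) = *-pres-∣ p∣b (product∣^length ps ps∣b)

ρ∣⇒∣^ : ∀ {m b} .{{_ : NonZero m}} → ρ m ∣ b → ∃[ k ] m ∣ b ^ k
ρ∣⇒∣^ {m} {b} ρm∣b =
  length ps , subst (_∣ b ^ length ps) (sym m≡∏ps) (product∣^length ps ps∣b)
  where
  open PrimeFactorisation (factorise m)
    renaming (factors to ps; isFactorisation to m≡∏ps; factorsPrime to ps-prime)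
  ps∣b : All (_∣ b) ps
  ps∣b = All.tabulate λ p∈ps →
    ∣-trans (prime∣⇒∣ρ (All.lookup ps-prime p∈ps)
                       (subst (_ ∣_) (sym m≡∏ps) (∈⇒∣product p∈ps)))
            ρm∣b

βsearch-spec : ∀ k b →
  1 ≤ βsearch (suc k) b × βsearch (suc k) b ≤ suc k × ρ (βsearch (suc k) b) ∣ b
βsearch-spec zero b with ρ 1 ∣? b
... | yes ρ1∣b = ≤-refl , ≤-refl , ρ1∣b
... | no ρ1∤b  = contradiction (1∣ b) ρ1∤b  -- ρ 1 evaluates to 1
βsearch-spec (suc k) b with ρ (suc (suc k)) ∣? b
... | yes ρ∣b = s≤s z≤n , ≤-refl , ρ∣b
... | no _    = map₂ (map₁ m≤n⇒m≤1+n) (βsearch-spec k b)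

Kempner-prepend : ∀ {S b t x} j → S 0 → t < b → S t →
  Kempner S b x → x < b ^ j → Kempner S b (t * b ^ j + x)
Kempner-prepend {S} {b} {t} zero _ t<b St _ (s≤s z≤n) =
  subst (Kempner S b) (solve 2 (λ t b → t :+ b :* con 0 := t :* con 1 :+ con 0) refl t b)
    (kd t t<b St kz)
-- A short expansion is padded with a leading zero digit; this is where S 0 is needed.
Kempner-prepend {S} {b} {t} (suc j) S0 t<b St kz _ =
  subst (Kempner S b) (solve 3 (λ b t B → con 0 :+ b :* (t :* B :+ con 0) := t :* (b :* B) :+ con 0)
                        refl b t (b ^ j))
    (kd 0 0<b S0 (Kempner-prepend j S0 t<b St kz (m^n>0 b {{>-nonZero 0<b}} j)))
  where
  0<b : 0 < b
  0<b = ≤-<-trans z≤n t<b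
Kempner-prepend {S} {b} {t} (suc j) S0 t<b St (kd {x} d d<b Sd Kx) dbx<b^sj =
  subst (Kempner S b) (digit-prepend-≡ b t (b ^ j) d x)
    (kd d d<b Sd (Kempner-prepend j S0 t<b St Kx x<b^j))
  where
  x<b^j : x < b ^ j
  x<b^j = *-cancelˡ-< b x (b ^ j) (≤-<-trans (m≤n+m (b * x) d) dbx<b^sj)
  digit-prepend-≡ : ∀ b t B d x → d + b * (t * B + x) ≡ t * (b * B) + (d + b * x)
  digit-prepend-≡ = solve 5 (λ b t B d x → d :+ b :* (t :* B :+ x) := t :* (b :* B) :+ (d :+ b :* x)) refl

fraction< : ∀ {s m} B .{{_ : NonZero m}} .{{_ : NonZero B}} → s < m → s * B / m < B
fraction< {s} {m} B s<m = m<n*o⇒m/o<n (subst (s * B <_) (*-comm m B) (*-monoˡ-< B s<m))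

remainder-digit< : ∀ {n m r} .{{_ : NonZero m}} → m ≤ n → r < m → r * suc n / m < n
remainder-digit< {n} {m} {r} m≤n r<m = m<n*o⇒m/o<n (begin-strict
  r * suc n   ≡⟨ *-suc r n ⟩
  r + r * n   <⟨ +-monoˡ-< (r * n) (<-≤-trans r<m m≤n) ⟩
  n + r * n   ≤⟨ *-monoˡ-≤ n r<m ⟩
  m * n       ≡⟨ *-comm m n ⟩
  n * m       ∎)
  where open ≤-Reasoning

module _ {n m : ℕ} .{{_ : NonZero m}} (m≤n : m ≤ n) where

  private
    b : ℕ
    b = suc n

    0<n : 0 < n
    0<n = <-≤-trans (>-nonZero⁻¹ m) m≤n

  long-division-step : ∀ s j →
    s * b ^ suc j ≡ s * b / m * b ^ j * m + s * b % m * b ^ j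
  long-division-step s j = begin
    s * (b * b ^ j)              ≡⟨ *-assoc s b (b ^ j) ⟨
    s * b * b ^ j                ≡⟨ cong (_* b ^ j) (m≡m%n+[m/n]*n (s * b) m) ⟩
    (r + t * m) * b ^ j          ≡⟨ solve 4 (λ r t m B → (r :+ t :* m) :* B := t :* B :* m :+ r :* B)
                                      refl r t m (b ^ j) ⟩
    t * b ^ j * m + r * b ^ j    ∎
    where
    open ≡-Reasoning
    t r : ℕ
    t = s * b / m
    r = s * b % m

  Kempner-fraction : ∀ j {s} → s < m → Kempner (Upto-b-2 b) b (s * b ^ j / m)
  Kempner-fraction zero {s} s<m =
    subst (Kempner (Upto-b-2 b) b) (sym (m<n⇒m/n≡0 (subst (_< m) (sym (*-identityʳ s)) s<m))) kz
  Kempner-fraction (suc j) {s} s<m =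
    subst (Kempner (Upto-b-2 b) b) (sym s*b^sj/m≡)
      (Kempner-prepend j 0<n (m<n⇒m<1+n t<n) t<n (Kempner-fraction j r<m) (fraction< (b ^ j) r<m))
    where
    instance
      b^j≢0 : NonZero (b ^ j)
      b^j≢0 = m^n≢0 b j
    t r : ℕ
    t = s * b / m
    r = s * b % m
    r<m : r < m
    r<m = m%n<n (s * b) m
    t<n : t < n
    t<n = remainder-digit< m≤n s<m
    s*b^sj/m≡ : s * b ^ suc j / m ≡ t * b ^ j + r * b ^ j / m
    s*b^sj/m≡ = begin
      s * b ^ suc j / m                     ≡⟨ /-congˡ (long-division-step s j) ⟩
      (t * b ^ j * m + r * b ^ j) / m       ≡⟨ +-distrib-/-∣ˡ (r * b ^ j) (n∣m*n (t * b ^ j)) ⟩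
      t * b ^ j * m / m + r * b ^ j / m     ≡⟨ cong (_+ r * b ^ j / m) (m*n/n≡m (t * b ^ j) m) ⟩
      t * b ^ j + r * b ^ j / m             ∎
      where open ≡-Reasoning

  Kempner-AP : ∃[ k ] m ∣ b ^ k → ContainsAP (Kempner (Upto-b-2 b) b) (n * m)
  Kempner-AP (k , divides zero b^k≡0) = contradiction b^k≡0 (≢-nonZero⁻¹ (b ^ k) {{m^n≢0 b k}})
  Kempner-AP (k , divides c@(suc _) b^k≡c*m) = 0 , c , z<s , λ i i<n*m →
    subst (Kempner (Upto-b-2 b) b) (AP-term≡ i)
      (Kempner-prepend k 0<n (m<n⇒m<1+n (m<n*o⇒m/o<n i<n*m)) (m<n*o⇒m/o<n i<n*m)
        (Kempner-fraction k (m%n<n i m)) (fraction< (b ^ k) (m%n<n i m)))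
    where
    instance
      b^k≢0 : NonZero (b ^ k)
      b^k≢0 = m^n≢0 b k
    AP-term≡ : ∀ i → i / m * b ^ k + i % m * b ^ k / m ≡ i * c
    AP-term≡ i = begin
      i / m * b ^ k + i % m * b ^ k / m        ≡⟨ cong (λ B → i / m * B + i % m * B / m) b^k≡c*m ⟩
      i / m * (c * m) + i % m * (c * m) / m    ≡⟨ cong (i / m * (c * m) +_) (begin
        i % m * (c * m) / m                        ≡⟨ /-congˡ (*-assoc (i % m) c m) ⟨
        i % m * c * m / m                          ≡⟨ m*n/n≡m (i % m * c) m ⟩
        i % m * c                                  ∎) ⟩
      i / m * (c * m) + i % m * c              ≡⟨ solve 4 (λ q c m r → q :* (c :* m) :+ r :* c := (r :+ q :* m) :* c)
                                                    refl (i / m) c m (i % m) ⟩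
      (i % m + i / m * m) * c                  ≡⟨ cong (_* c) (m≡m%n+[m/n]*n i m) ⟨
      i * c                                    ∎
      where open ≡-Reasoning

proposition2p3 : ∀ (b : ℕ) → 2 ≤ b →
    ContainsAP (Kempner (Upto-b-2 b) b) ((b ∸ 1) * β b) × ℓ≥ b ((b ∸ 1) * β b)
proposition2p3 b@(suc (suc n)) _ = AP , Upto-b-2 b , (z<s , suc n , ≤-refl , <-irrefl refl) , AP
  where
  AP : ContainsAP (Kempner (Upto-b-2 b) b) (suc n * β b)
  AP with βsearch-spec n b
  ... | 1≤β , β≤b-1 , ρβ∣b = Kempner-AP {{β≢0}} β≤b-1 (ρ∣⇒∣^ {{β≢0}} ρβ∣b)
    where
    β≢0 : NonZero (β b)
    β≢0 = >-nonZero 1≤β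
proposition2p3 (suc zero) (s≤s ())
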